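{- Let $G$ be a multitriangulation of the projective plane. Then $G$ has a vertex of degree 2, a vertex of degree 3, a vertex of degree 4, a vertex of degree 6, or two adjacent vertices of degree 5.
   Context: A multitriangulation of a surface is a loopless graph, possibly with multiple edges, 2-cell embedded on the surface so that every facial closed walk has length 3. -}

module Defs where

open import Data.Nat using (ℕ; _+_; ⌊_/2⌋)
open import Data.Fin using (Fin; _≟_)
open import Data.List using (List; length; filter; allFin)
open import Data.Product using (Σ; ∃; _×_; _,_)
open import Relation.Binary.PropositionalEquality using (_≡_; _≢_)

-- Generalized maps encode exactly the 2-cell embeddings of graphs in
-- closed (possibly non-orientable) surfaces.
record GMap (n : ℕ) : Set where
  field
    α0 α1 α2 : Fin n → Fin n
    α0-invol : ∀ x → α0 (α0 x) ≡ x
    α1-invol : ∀ x → α1 (α1 x) ≡ x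
    α2-invol : ∀ x → α2 (α2 x) ≡ x
    α0-free  : ∀ x → α0 x ≢ x
    α1-free  : ∀ x → α1 x ≢ x
    α2-free  : ∀ x → α2 x ≢ x
    α02-comm : ∀ x → α0 (α2 x) ≡ α2 (α0 x)
    α02-free : ∀ x → α0 (α2 x) ≢ x

data Orb2 {n : ℕ} (a b : Fin n → Fin n) : Fin n → Fin n → Set where
  here  : ∀ {x} → Orb2 a b x x
  stepa : ∀ {x y} → Orb2 a b x y → Orb2 a b x (a y)
  stepb : ∀ {x y} → Orb2 a b x y → Orb2 a b x (b y)

data Orb3 {n : ℕ} (a b c : Fin n → Fin n) : Fin n → Fin n → Set where
  here  : ∀ {x} → Orb3 a b c x x
  stepa : ∀ {x y} → Orb3 a b c x y → Orb3 a b c x (a y)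
  stepb : ∀ {x y} → Orb3 a b c x y → Orb3 a b c x (b y)
  stepc : ∀ {x y} → Orb3 a b c x y → Orb3 a b c x (c y)

-- An enumeration of the orbits of ⟨a,b⟩ by Fin k: a surjection whose
-- fibres are exactly the orbits (so k is the number of orbits).
record OrbitLabelling {n : ℕ} (k : ℕ) (a b : Fin n → Fin n) : Set where
  field
    label    : Fin n → Fin k
    surj     : ∀ c → ∃ λ f → label f ≡ c
    sameOrb⇒ : ∀ x y → label x ≡ label y → Orb2 a b x y
    ⇒sameOrb : ∀ x y → Orb2 a b x y → label x ≡ label y

fibreSize : ∀ {n k} → (Fin n → Fin k) → Fin k → ℕ
fibreSize {n} lab c = length (filter (λ f → lab f ≟ c) (allFin n))

-- A multitriangulation of the projective plane, encoded as a generalized map: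
-- vertices = ⟨α1,α2⟩-orbits, edges = ⟨α0,α2⟩-orbits, faces = ⟨α0,α1⟩-orbits.
record PPMultitriangulation (n : ℕ) : Set where
  field
    gmap : GMap n
  open GMap gmap public
  field
    #V #E #F : ℕ
    vertices : OrbitLabelling #V α1 α2
    edges    : OrbitLabelling #E α0 α2
    faces    : OrbitLabelling #F α0 α1
    connected : ∀ x y → Orb3 α0 α1 α2 x y
    -- Euler characteristic V - E + F = 1: the connected closed surface is
    -- the projective plane (orientable surfaces have even characteristic)
    euler : #V + #F ≡ #E + 1
    loopless : ∀ x → OrbitLabelling.label vertices x
                   ≢ OrbitLabelling.label vertices (α0 x)
    -- every facial walk has length 3 (a face of length l has 2l flags)
    triangular : ∀ c → fibreSize (OrbitLabelling.label faces) c ≡ 6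

  vertexOf : Fin n → Fin #V
  vertexOf = OrbitLabelling.label vertices

  -- degree of a vertex (edges counted with multiplicity; no loops)
  degree : Fin #V → ℕ
  degree v = ⌊ fibreSize vertexOf v /2⌋

  Adjacent : Fin #V → Fin #V → Set
  Adjacent u v = ∃ λ x → vertexOf x ≡ u × vertexOf (α0 x) ≡ v

-- Count the n flags: n = 6F since faces are triangles and n ≤ 4E since an edge carries at most
-- four flags, so Euler's formula V − E + F = 1 gives n + 12 ≤ 12V (the average degree is below 6).
-- Suppose no vertex has degree 2, 3, 4 or 6 and no two vertices of degree 5 are adjacent. Degree 1
-- would force a loop, so every vertex has degree 5 (10 flags) or at least 7 (at least 14 flags);
-- weighting flags by 420/10 = 42 resp. 420/14 = 30 gives 420V ≤ 42 n₅ + 30 n₇, where n₅ and n₇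
-- count the flags at the two kinds of vertices. Let a flag receive one unit when the other end of
-- its edge has degree 5. This hands out n₅ units, and since the corners of a triangle are pairwise
-- adjacent, the two flags at a corner of a triangle receive at most one unit together and none at
-- a corner of degree 5; hence 2n₅ ≤ n₇. With n₅ + n₇ = n the three inequalities are inconsistent.

module Submission where

open import Data.Bool using (true; false; if_then_else_)
open import Data.Empty using (⊥; ⊥-elim)
open import Data.Fin using (Fin; zero; suc; toℕ; fromℕ<; _≟_)
open import Data.Fin.Properties using (any?; toℕ-fromℕ<; toℕ<n; <-cmp)
open import Data.List using (length; filter; tabulate; _∷_; [])
open import Data.Nat using (ℕ; zero; suc; _+_; _*_; _≤_; _<_; z≤n; s≤s; z<s)
import Data.Nat as Nat
open import Data.Nat.Properties hiding (_≟_; <-cmp)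
open import Data.Nat.Tactic.RingSolver using (solve)
open import Algebra.Properties.Semiring.Sum +-*-semiring
  using (sum; sum-replicate-zero; sum-cong-≗; ∑-comm; ∑-distrib-+; ∑-permute; *-distribˡ-sum)
open import Data.Product using (∃; _×_; _,_)
open import Data.Sum using (_⊎_; inj₁; inj₂)
open import Function using (_∘_; id)
open import Function.Bundles using (mk↔ₛ′)
open import Function.Definitions using (Injective)
open import Relation.Binary using (tri<; tri≈; tri>)
open import Relation.Binary.PropositionalEquality
open import Relation.Nullary using (¬_; Dec; yes; no; does)
open import Relation.Nullary.Decidable using (from-no; ¬?; map′; _⊎-dec_; _×-dec_)
open import Relation.Unary using (Pred; Decidable)

open import Defs

𝟙 : ∀ {p} {P : Set p} → Dec P → ℕ
𝟙 d = if does d then 1 else 0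

𝟙+𝟙¬ : ∀ {p} {P : Set p} (d : Dec P) → 𝟙 d + 𝟙 (¬? d) ≡ 1
𝟙+𝟙¬ (yes _) = refl
𝟙+𝟙¬ (no _)  = refl

δ : ∀ {n} → Fin n → Fin n → ℕ
δ a b = 𝟙 (a ≟ b)

δ-refl : ∀ {n} (a : Fin n) → δ a a ≡ 1
δ-refl a with a ≟ a
... | yes _  = refl
... | no a≢a = ⊥-elim (a≢a refl)

∑-const : ∀ n k → sum {n} (λ _ → k) ≡ n * k
∑-const zero    k = refl
∑-const (suc n) k = cong (k +_) (∑-const n k)

∑-ones : ∀ n → sum {n} (λ _ → 1) ≡ n
∑-ones n = trans (∑-const n 1) (*-identityʳ n)

∑-mono-≤ : ∀ {n} {f g : Fin n → ℕ} → (∀ i → f i ≤ g i) → sum f ≤ sum g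
∑-mono-≤ {zero}  f≤g = z≤n
∑-mono-≤ {suc n} f≤g = +-mono-≤ (f≤g zero) (∑-mono-≤ (f≤g ∘ suc))

term≤∑ : ∀ {n} (f : Fin n → ℕ) i → f i ≤ sum f
term≤∑ f zero    = m≤m+n _ _
term≤∑ f (suc i) = ≤-trans (term≤∑ (f ∘ suc) i) (m≤n+m _ _)

∑-δ-* : ∀ {n} (a : Fin n) (g : Fin n → ℕ) → sum (λ y → δ a y * g y) ≡ g a
∑-δ-* {suc n} zero    g = trans (cong₂ _+_ (*-identityˡ (g zero)) (sum-replicate-zero n)) (+-identityʳ _)
∑-δ-* {suc n} (suc a) g = ∑-δ-* a (g ∘ suc)

∑-δ : ∀ {n} (a : Fin n) → sum (δ a) ≡ 1
∑-δ a = trans (sum-cong-≗ (λ y → sym (*-identityʳ (δ a y)))) (∑-δ-* a (λ _ → 1))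

∑-involution : ∀ {n} (σ : Fin n → Fin n) → (∀ x → σ (σ x) ≡ x) →
               (g : Fin n → ℕ) → sum (g ∘ σ) ≡ sum g
∑-involution σ σ-invol g = sym (∑-permute g (mk↔ₛ′ σ σ σ-invol σ-invol))

count : ∀ {n p} {P : Pred (Fin n) p} → Decidable P → ℕ
count P? = sum (λ y → 𝟙 (P? y))

count-none : ∀ {n p} {P : Pred (Fin n) p} (P? : Decidable P) →
             (∀ y → ¬ P y) → count P? ≡ 0
count-none {n} P? none = trans (sum-cong-≗ 𝟙-no) (sum-replicate-zero n)
  where
  𝟙-no : ∀ y → 𝟙 (P? y) ≡ 0
  𝟙-no y with P? y
  ... | yes p = ⊥-elim (none y p)
  ... | no _  = refl

count-≤ : ∀ {m n p} {P : Pred (Fin n) p} (P? : Decidable P) (f : Fin m → Fin n) →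
          (∀ {y} → P y → ∃ λ i → f i ≡ y) → count P? ≤ m
count-≤ {m} P? f covers = begin
  count P?                        ≤⟨ ∑-mono-≤ 𝟙≤hits ⟩
  sum (λ y → sum (λ i → δ (f i) y)) ≡⟨ ∑-comm (λ y i → δ (f i) y) ⟩
  sum (λ i → sum (δ (f i)))       ≡⟨ sum-cong-≗ (∑-δ ∘ f) ⟩
  sum {m} (λ _ → 1)               ≡⟨ ∑-ones m ⟩
  m                               ∎
  where
  open ≤-Reasoning
  𝟙≤hits : ∀ y → 𝟙 (P? y) ≤ sum (λ i → δ (f i) y)
  𝟙≤hits y with P? y
  ... | no _  = z≤n
  ... | yes p with covers p
  ... | i , refl = subst (_≤ sum (λ j → δ (f j) (f i))) (δ-refl (f i)) (term≤∑ _ i)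

count-≥ : ∀ {m n p} {P : Pred (Fin n) p} (P? : Decidable P) (f : Fin m → Fin n) →
          Injective _≡_ _≡_ f → (∀ i → P (f i)) → m ≤ count P?
count-≥ {m} P? f f-inj P-f = begin
  m                                 ≡⟨ ∑-ones m ⟨
  sum {m} (λ _ → 1)                 ≡⟨ sum-cong-≗ (∑-δ ∘ f) ⟨
  sum (λ i → sum (δ (f i)))         ≡⟨ ∑-comm (λ i y → δ (f i) y) ⟩
  sum (λ y → count (λ i → f i ≟ y)) ≤⟨ ∑-mono-≤ hits≤𝟙 ⟩
  count P?                          ∎
  where
  open ≤-Reasoning
  hits≤𝟙 : ∀ y → count (λ i → f i ≟ y) ≤ 𝟙 (P? y)
  hits≤𝟙 y with any? (λ i → f i ≟ y)
  ... | no  none = subst (_≤ 𝟙 (P? y)) (sym (count-none (λ i → f i ≟ y) (λ i fi≡y → none (i , fi≡y)))) z≤n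
  ... | yes (i , refl) with P? (f i)
  ...   | yes _   = count-≤ (λ j → f j ≟ f i) (λ (_ : Fin 1) → i) (λ fj≡fi → zero , f-inj (sym fj≡fi))
  ...   | no ¬Pfi = ⊥-elim (¬Pfi (P-f i))

length-filter-tabulate : ∀ {n p} {A : Set} {P : Pred A p} (P? : Decidable P) (f : Fin n → A) →
                         length (filter P? (tabulate f)) ≡ count (P? ∘ f)
length-filter-tabulate {zero}  P? f = refl
length-filter-tabulate {suc n} P? f with does (P? (f zero))
... | true  = cong suc (length-filter-tabulate P? (f ∘ suc))
... | false = length-filter-tabulate P? (f ∘ suc)

module _ {n k} (lab : Fin n → Fin k) where

  fibreSize≡count : ∀ c → fibreSize lab c ≡ count (λ x → lab x ≟ c)
  fibreSize≡count c = length-filter-tabulate (λ x → lab x ≟ c) id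

  ∑-fibres : (g : Fin k → ℕ) → sum (λ c → g c * fibreSize lab c) ≡ sum (g ∘ lab)
  ∑-fibres g = begin
    sum (λ c → g c * fibreSize lab c)
      ≡⟨ sum-cong-≗ (λ c → cong (g c *_) (fibreSize≡count c)) ⟩
    sum (λ c → g c * sum (λ x → δ (lab x) c))
      ≡⟨ sum-cong-≗ (λ c → *-distribˡ-sum (g c) (λ x → δ (lab x) c)) ⟩
    sum (λ c → sum (λ x → g c * δ (lab x) c))
      ≡⟨ ∑-comm (λ c x → g c * δ (lab x) c) ⟩
    sum (λ x → sum (λ c → g c * δ (lab x) c))
      ≡⟨ sum-cong-≗ (λ x → sum-cong-≗ (λ c → *-comm (g c) (δ (lab x) c))) ⟩
    sum (λ x → sum (λ c → δ (lab x) c * g c))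
      ≡⟨ sum-cong-≗ (λ x → ∑-δ-* (lab x) g) ⟩
    sum (g ∘ lab) ∎
    where open ≡-Reasoning

  ∑-fibreSize : sum (fibreSize lab) ≡ n
  ∑-fibreSize = begin
    sum (fibreSize lab)                ≡⟨ sum-cong-≗ (λ c → *-identityˡ (fibreSize lab c)) ⟨
    sum (λ c → 1 * fibreSize lab c)    ≡⟨ ∑-fibres (λ _ → 1) ⟩
    sum {n} (λ _ → 1)                  ≡⟨ ∑-ones n ⟩
    n                                  ∎
    where open ≡-Reasoning

even-or-odd : ∀ d → ∃ λ e → d ≡ e + e ⊎ d ≡ suc (e + e)
even-or-odd zero          = 0 , inj₁ refl
even-or-odd (suc zero)    = 0 , inj₂ refl
even-or-odd (suc (suc d)) with even-or-odd d
... | e , inj₁ d≡2e  = suc e , inj₁ (cong suc (trans (cong suc d≡2e) (sym (+-suc e e))))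
... | e , inj₂ d≡2e+1 = suc e , inj₂ (cong suc (trans (cong suc d≡2e+1) (sym (cong suc (+-suc e e)))))

+-double-suc : ∀ i e → i + (suc e + suc e) ≡ suc (suc (i + (e + e)))
+-double-suc i e = trans (+-suc i (e + suc e)) (cong suc (trans (cong (i +_) (+-suc e e)) (+-suc i (e + e))))

-- The ⟨a, b⟩-orbit of x is swept out by the walk x, a x, b (a x), …, which visits distinct flags
-- until it returns to x, necessarily after an even number of steps.
module AlternatingWalk {n} (a b : Fin n → Fin n)
  (a-invol : ∀ y → a (a y) ≡ y) (b-invol : ∀ y → b (b y) ≡ y)
  (a-free : ∀ y → a y ≢ y) (b-free : ∀ y → b y ≢ y) (x : Fin n) where

  step : ℕ → Fin n → Fin n
  step zero          = a
  step (suc zero)    = b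
  step (suc (suc k)) = step k

  walk : ℕ → Fin n
  walk zero    = x
  walk (suc k) = step k (walk k)

  step-invol : ∀ k y → step k (step k y) ≡ y
  step-invol zero          = a-invol
  step-invol (suc zero)    = b-invol
  step-invol (suc (suc k)) = step-invol k

  step-free : ∀ k y → step k y ≢ y
  step-free zero          = a-free
  step-free (suc zero)    = b-free
  step-free (suc (suc k)) = step-free k

  step-injective : ∀ k {y z} → step k y ≡ step k z → y ≡ z
  step-injective k {y} {z} eq = trans (sym (step-invol k y)) (trans (cong (step k) eq) (step-invol k z))

  step-parity : ∀ k → (step k ≡ a × step (suc k) ≡ b) ⊎ (step k ≡ b × step (suc k) ≡ a)
  step-parity zero          = inj₁ (refl , refl)
  step-parity (suc zero)    = inj₂ (refl , refl)
  step-parity (suc (suc k)) = step-parity k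

  step-+-even : ∀ k e → step (k + (e + e)) ≡ step k
  step-+-even k zero    = cong step (+-identityʳ k)
  step-+-even k (suc e) = trans (cong step (+-double-suc k e)) (step-+-even k e)

  step-in-orbit : ∀ k {y} → Orb2 a b x y → Orb2 a b x (step k y)
  step-in-orbit zero          = stepa
  step-in-orbit (suc zero)    = stepb
  step-in-orbit (suc (suc k)) = step-in-orbit k

  walk-in-orbit : ∀ k → Orb2 a b x (walk k)
  walk-in-orbit zero    = here
  walk-in-orbit (suc k) = step-in-orbit k (walk-in-orbit k)

  module _ (e : ℕ) (returns : walk (suc e + suc e) ≡ x) where

    private
      m = suc e + suc e

      InWalk : Fin n → Set
      InWalk y = ∃ λ i → i < m × walk i ≡ y

      forward : ∀ {i} → i < m → InWalk (step i (walk i))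
      forward {i} i<m with m≤n⇒m<n∨m≡n i<m
      ... | inj₁ i+1<m = suc i , i+1<m , refl
      ... | inj₂ refl  = 0 , z<s , sym returns

      backward : ∀ {i} → i < m → InWalk (step (suc i) (walk i))
      backward {zero} _ = e + suc e , n<1+n _ , sym (begin
        step 1 x
          ≡⟨ cong (step 1) (sym returns) ⟩
        step 1 (step (e + suc e) (walk (e + suc e)))
          ≡⟨ cong (λ k → step 1 (step k (walk (e + suc e)))) (+-suc e e) ⟩
        step 1 (step (1 + (e + e)) (walk (e + suc e)))
          ≡⟨ cong (λ s → step 1 (s (walk (e + suc e)))) (step-+-even 1 e) ⟩
        step 1 (step 1 (walk (e + suc e)))
          ≡⟨ step-invol 1 _ ⟩
        walk (e + suc e) ∎)
        where open ≡-Reasoning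
      backward {suc i} i+1<m = i , <-trans (n<1+n i) i+1<m , sym (step-invol i (walk i))

      closed : ∀ {i} → i < m → (g : Fin n → Fin n) →
               g ≡ step i ⊎ g ≡ step (suc i) → InWalk (g (walk i))
      closed i<m _ (inj₁ refl) = forward i<m
      closed i<m _ (inj₂ refl) = backward i<m

      a-closed : ∀ {i} → i < m → InWalk (a (walk i))
      a-closed {i} i<m with step-parity i
      ... | inj₁ (a≡ , _) = closed i<m a (inj₁ (sym a≡))
      ... | inj₂ (_ , a≡) = closed i<m a (inj₂ (sym a≡))

      b-closed : ∀ {i} → i < m → InWalk (b (walk i))
      b-closed {i} i<m with step-parity i
      ... | inj₁ (_ , b≡) = closed i<m b (inj₂ (sym b≡))
      ... | inj₂ (b≡ , _) = closed i<m b (inj₁ (sym b≡))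

      orbit⊆walk : ∀ {y} → Orb2 a b x y → InWalk y
      orbit⊆walk here = 0 , z<s , refl
      orbit⊆walk (stepa o) with orbit⊆walk o
      ... | i , i<m , refl = a-closed i<m
      orbit⊆walk (stepb o) with orbit⊆walk o
      ... | i , i<m , refl = b-closed i<m

    walk-covers-orbit : ∀ {y} → Orb2 a b x y → ∃ λ (i : Fin m) → walk (toℕ i) ≡ y
    walk-covers-orbit o with orbit⊆walk o
    ... | i , i<m , walk-i≡y = fromℕ< i<m , trans (cong walk (toℕ-fromℕ< i<m)) walk-i≡y

  walk-even-gap : ∀ i e → walk i ≡ walk (i + (e + e)) → walk (e + e) ≡ x
  walk-even-gap zero    e eq = sym eq
  walk-even-gap (suc i) e eq = walk-even-gap i e (step-injective i (trans eq
    (cong (λ s → s (walk (i + (e + e)))) (step-+-even i e))))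

  walk-odd-gap : ∀ i e → walk i ≢ walk (suc (i + (e + e)))
  walk-odd-gap i zero eq = step-free i (walk i) (sym (trans eq
    (cong (λ k → step k (walk k)) (+-identityʳ i))))
  walk-odd-gap i (suc e) eq = walk-odd-gap (suc i) e (trans (cong (step i) eq) (begin
    step i (walk (suc (i + (suc e + suc e))))
      ≡⟨ cong (λ s → step i (s (walk (i + (suc e + suc e))))) (step-+-even i (suc e)) ⟩
    step i (step i (walk (i + (suc e + suc e))))  ≡⟨ step-invol i _ ⟩
    walk (i + (suc e + suc e))                    ≡⟨ cong walk (+-double-suc i e) ⟩
    walk (suc (suc (i + (e + e))))                ∎))
    where open ≡-Reasoning

  module _ (m : ℕ) (no-early-return : ∀ e → suc e + suc e < m → walk (suc e + suc e) ≢ x) where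

    walk-distinct : ∀ {i j} → i < j → j < m → walk i ≢ walk j
    walk-distinct {i} i<j j<m eq with m≤n⇒∃[o]m+o≡n i<j
    ... | d , refl with even-or-odd d
    ... | e , inj₁ refl = walk-odd-gap i e eq
    ... | e , inj₂ refl = no-early-return e gap<m (walk-even-gap i (suc e) (trans eq (cong walk j≡i+gap)))
      where
      gap<m : suc e + suc e < m
      gap<m = ≤-<-trans (≤-reflexive (+-double-suc 0 e)) (≤-<-trans (+-monoˡ-≤ (suc (e + e)) (s≤s z≤n)) j<m)
      j≡i+gap : suc i + suc (e + e) ≡ i + (suc e + suc e)
      j≡i+gap = trans (cong suc (+-suc i (e + e))) (sym (+-double-suc i e))

    walk-injective : Injective _≡_ _≡_ (λ (i : Fin m) → walk (toℕ i))
    walk-injective {i} {j} eq with <-cmp i j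
    ... | tri< i<j _ _ = ⊥-elim (walk-distinct i<j (toℕ<n j) eq)
    ... | tri≈ _ i≡j _ = i≡j
    ... | tri> _ _ j<i = ⊥-elim (walk-distinct j<i (toℕ<n i) (sym eq))

  module _ {k} (L : OrbitLabelling k a b) where
    open OrbitLabelling L

    orbit-size-≤ : ∀ e → walk (suc e + suc e) ≡ x → fibreSize label (label x) ≤ suc e + suc e
    orbit-size-≤ e returns = subst (_≤ suc e + suc e) (sym (fibreSize≡count label (label x)))
      (count-≤ (λ y → label y ≟ label x) (walk ∘ toℕ)
        (λ same → walk-covers-orbit e returns (sameOrb⇒ x _ (sym same))))

    orbit-size-≥ : ∀ m → (∀ e → suc e + suc e < m → walk (suc e + suc e) ≢ x) →
                   m ≤ fibreSize label (label x)
    orbit-size-≥ m no-early-return = subst (m ≤_) (sym (fibreSize≡count label (label x)))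
      (count-≥ (λ y → label y ≟ label x) (walk ∘ toℕ) (walk-injective m no-early-return)
        (λ i → sym (⇒sameOrb x _ (walk-in-orbit (toℕ i)))))

euler-flag-bound : ∀ {V E F n} → V + F ≡ E + 1 → n ≡ F * 6 → n ≤ E * 4 → n + 12 ≤ 12 * V
euler-flag-bound {V} {E} {F} {n} euler n≡6F n≤4E = +-cancelˡ-≤ (2 * n) (n + 12) (12 * V) (begin
  2 * n + (n + 12)      ≡⟨ solve (n ∷ []) ⟩
  3 * n + 12            ≤⟨ +-monoˡ-≤ 12 (*-monoʳ-≤ 3 n≤4E) ⟩
  3 * (E * 4) + 12      ≡⟨ solve (E ∷ []) ⟩
  12 * (E + 1)          ≡⟨ cong (12 *_) euler ⟨
  12 * (V + F)          ≡⟨ solve (V ∷ F ∷ []) ⟩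
  2 * (F * 6) + 12 * V  ≡⟨ cong (λ t → 2 * t + 12 * V) n≡6F ⟨
  2 * n + 12 * V        ∎)
  where open ≤-Reasoning

discharging-contradiction : ∀ {V n N₅ N₇} → N₅ + N₇ ≡ n → n + 12 ≤ 12 * V →
  420 * V ≤ 42 * N₅ + 30 * N₇ → N₅ + N₅ ≤ N₇ → ⊥
discharging-contradiction {V} {n} {N₅} {N₇} partition euler-bound weight-bound N₅-bound =
  m+1+n≰m (42 * N₅ + 30 * N₇) (begin
    42 * N₅ + 30 * N₇ + (420 + 3 * N₅)       ≡⟨ solve (N₅ ∷ N₇ ∷ []) ⟩
    35 * N₅ + 30 * N₇ + 5 * (N₅ + N₅) + 420
      ≤⟨ +-monoˡ-≤ 420 (+-monoʳ-≤ (35 * N₅ + 30 * N₇) (*-monoʳ-≤ 5 N₅-bound)) ⟩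
    35 * N₅ + 30 * N₇ + 5 * N₇ + 420         ≡⟨ solve (N₅ ∷ N₇ ∷ []) ⟩
    35 * (N₅ + N₇ + 12)                       ≡⟨ cong (λ t → 35 * (t + 12)) partition ⟩
    35 * (n + 12)                             ≤⟨ *-monoʳ-≤ 35 euler-bound ⟩
    35 * (12 * V)                             ≡⟨ *-assoc 35 12 V ⟨
    420 * V                                   ≤⟨ weight-bound ⟩
    42 * N₅ + 30 * N₇                         ∎)
  where open ≤-Reasoning

module Multitriangulation {n} (G : PPMultitriangulation n) where
  open PPMultitriangulation G
  open OrbitLabelling using (label; surj; ⇒sameOrb)

  module FaceWalk   = AlternatingWalk α0 α1 α0-invol α1-invol α0-free α1-free
  module EdgeWalk   = AlternatingWalk α0 α2 α0-invol α2-invol α0-free α2-free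
  module VertexWalk = AlternatingWalk α1 α2 α1-invol α2-invol α1-free α2-free

  -- The face orbit has 6 flags: an earlier return of the walk would make it smaller, none by step 6 larger.
  faces-are-triangles : ∀ x → α1 (α0 (α1 (α0 (α1 (α0 x))))) ≡ x
  faces-are-triangles x = returns-after-six (walk 2 ≟ x) (walk 4 ≟ x) (walk 6 ≟ x)
    where
    open FaceWalk x

    six : fibreSize (label faces) (label faces x) ≡ 6
    six = triangular (label faces x)

    returns-after-six : Dec (walk 2 ≡ x) → Dec (walk 4 ≡ x) → Dec (walk 6 ≡ x) → walk 6 ≡ x
    returns-after-six (yes w2≡x) _ _ =
      ⊥-elim (from-no (6 ≤? 2) (subst (_≤ 2) six (orbit-size-≤ faces 0 w2≡x)))
    returns-after-six (no _) (yes w4≡x) _ =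
      ⊥-elim (from-no (6 ≤? 4) (subst (_≤ 4) six (orbit-size-≤ faces 1 w4≡x)))
    returns-after-six (no _) (no _) (yes w6≡x) = w6≡x
    returns-after-six (no w2≢x) (no w4≢x) (no w6≢x) =
      ⊥-elim (from-no (7 ≤? 6) (subst (7 ≤_) six (orbit-size-≥ faces 7 no-early-return)))
      where
      no-early-return : ∀ e → suc e + suc e < 7 → walk (suc e + suc e) ≢ x
      no-early-return 0 _ = w2≢x
      no-early-return 1 _ = w4≢x
      no-early-return 2 _ = w6≢x
      no-early-return (suc (suc (suc e))) (s≤s (s≤s (s≤s (s≤s (s≤s le))))) =
        ⊥-elim (from-no (4 ≤? 2) (m+n≤o⇒m≤o 4 (m+n≤o⇒n≤o e le)))

  vertexOf-α1 : ∀ y → vertexOf (α1 y) ≡ vertexOf y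
  vertexOf-α1 y = sym (⇒sameOrb vertices y (α1 y) (stepa here))

  vertexOf-α2 : ∀ y → vertexOf (α2 y) ≡ vertexOf y
  vertexOf-α2 y = sym (⇒sameOrb vertices y (α2 y) (stepb here))

  third-side : ∀ y → Adjacent (vertexOf (α0 y)) (vertexOf (α0 (α1 y)))
  third-side y = α1 (α0 y) , vertexOf-α1 (α0 y) , (begin
    vertexOf (α0 (α1 (α0 y)))              ≡⟨ vertexOf-α1 _ ⟨
    vertexOf (α1 (α0 (α1 (α0 y))))         ≡⟨ cong vertexOf (α0-swap (α1-swap (faces-are-triangles y))) ⟩
    vertexOf (α0 (α1 y))                   ∎)
    where
    open ≡-Reasoning
    α0-swap : ∀ {u v} → α0 u ≡ v → u ≡ α0 v
    α0-swap {u} refl = sym (α0-invol u)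
    α1-swap : ∀ {u v} → α1 u ≡ v → u ≡ α1 v
    α1-swap {u} refl = sym (α1-invol u)

  no-degree-one : ∀ x → α2 (α1 x) ≢ x
  no-degree-one x α2α1x≡x with third-side x
  ... | w , w~α0x , α0w~α0α1x = loopless w (begin
    vertexOf w              ≡⟨ w~α0x ⟩
    vertexOf (α0 x)         ≡⟨ vertexOf-α2 (α0 x) ⟨
    vertexOf (α2 (α0 x))    ≡⟨ cong vertexOf (α02-comm x) ⟨
    vertexOf (α0 (α2 x))    ≡⟨ cong (vertexOf ∘ α0) α2x≡α1x ⟩
    vertexOf (α0 (α1 x))    ≡⟨ α0w~α0α1x ⟨
    vertexOf (α0 w)         ∎)
    where
    open ≡-Reasoning
    α2x≡α1x : α2 x ≡ α1 x
    α2x≡α1x = trans (cong α2 (sym α2α1x≡x)) (α2-invol (α1 x))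

  four-≤-vertex-flags : ∀ v → 4 ≤ fibreSize vertexOf v
  four-≤-vertex-flags v with surj vertices v
  ... | x , refl = VertexWalk.orbit-size-≥ x vertices 4 no-early-return
    where
    no-early-return : ∀ e → suc e + suc e < 4 → VertexWalk.walk x (suc e + suc e) ≢ x
    no-early-return 0 _ = no-degree-one x
    no-early-return (suc e) (s≤s (s≤s (s≤s le))) =
      ⊥-elim (from-no (2 ≤? 1) (m+n≤o⇒m≤o 2 (m+n≤o⇒n≤o e le)))

  edge-flags-≤-four : ∀ c → fibreSize (label edges) c ≤ 4
  edge-flags-≤-four c with surj edges c
  ... | x , refl = EdgeWalk.orbit-size-≤ x edges 1 (begin
    α2 (α0 (α2 (α0 x)))     ≡⟨ cong α2 (α02-comm (α0 x)) ⟩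
    α2 (α2 (α0 (α0 x)))     ≡⟨ α2-invol _ ⟩
    α0 (α0 x)               ≡⟨ α0-invol x ⟩
    x                       ∎)
    where open ≡-Reasoning

  Light : Fin #V → Set
  Light v = degree v ≡ 2 ⊎ degree v ≡ 3 ⊎ degree v ≡ 4 ⊎ degree v ≡ 6

  AdjacentFives : Set
  AdjacentFives = ∃ λ u → ∃ λ v → Adjacent u v × degree u ≡ 5 × degree v ≡ 5

  light? : Dec (∃ Light)
  light? = any? (λ v → degree v Nat.≟ 2 ⊎-dec degree v Nat.≟ 3
                       ⊎-dec degree v Nat.≟ 4 ⊎-dec degree v Nat.≟ 6)

  adjacent-fives? : Dec AdjacentFives
  adjacent-fives? = map′ (λ (x , p , q) → _ , _ , (x , refl , refl) , p , q)
                         (λ { (_ , _ , (x , refl , refl) , p , q) → x , p , q })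
                         (any? (λ x → degree (vertexOf x) Nat.≟ 5 ×-dec degree (vertexOf (α0 x)) Nat.≟ 5))

  two-≤-degree : ∀ v → 2 ≤ degree v
  two-≤-degree v = ⌊n/2⌋-mono (four-≤-vertex-flags v)

  degree+degree≤flags : ∀ v → degree v + degree v ≤ fibreSize vertexOf v
  degree+degree≤flags v =
    ≤-trans (+-monoʳ-≤ (degree v) (⌊n/2⌋≤⌈n/2⌉ s)) (≤-reflexive (⌊n/2⌋+⌈n/2⌉≡n s))
    where s = fibreSize vertexOf v

  flags≡six-faces : n ≡ #F * 6
  flags≡six-faces = begin
    n                              ≡⟨ ∑-fibreSize (label faces) ⟨
    sum (fibreSize (label faces))  ≡⟨ sum-cong-≗ triangular ⟩
    sum {#F} (λ _ → 6)             ≡⟨ ∑-const #F 6 ⟩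
    #F * 6                         ∎
    where open ≡-Reasoning

  flags≤four-edges : n ≤ #E * 4
  flags≤four-edges = begin
    n                              ≡⟨ ∑-fibreSize (label edges) ⟨
    sum (fibreSize (label edges))  ≤⟨ ∑-mono-≤ edge-flags-≤-four ⟩
    sum {#E} (λ _ → 4)             ≡⟨ ∑-const #E 4 ⟩
    #E * 4                         ∎
    where open ≤-Reasoning

  module Discharging (no-light : ¬ ∃ Light) (no-adjacent-fives : ¬ AdjacentFives) where

    five other : Fin #V → ℕ
    five  v = 𝟙 (degree v Nat.≟ 5)
    other v = 𝟙 (¬? (degree v Nat.≟ 5))

    flags₅ flags₇ : ℕ
    flags₅ = sum (five ∘ vertexOf)
    flags₇ = sum (other ∘ vertexOf)

    seven-≤-degree : ∀ v → degree v ≢ 5 → 7 ≤ degree v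
    seven-≤-degree v ≢5 = excluded (degree v) (two-≤-degree v) ≢5 (λ light → no-light (v , light))
      where
      excluded : ∀ d → 2 ≤ d → d ≢ 5 → ¬ (d ≡ 2 ⊎ d ≡ 3 ⊎ d ≡ 4 ⊎ d ≡ 6) → 7 ≤ d
      excluded 0 () _ _
      excluded 1 (s≤s ()) _ _
      excluded 2 _ _ light = ⊥-elim (light (inj₁ refl))
      excluded 3 _ _ light = ⊥-elim (light (inj₂ (inj₁ refl)))
      excluded 4 _ _ light = ⊥-elim (light (inj₂ (inj₂ (inj₁ refl))))
      excluded 5 _ ≢5 _    = ⊥-elim (≢5 refl)
      excluded 6 _ _ light = ⊥-elim (light (inj₂ (inj₂ (inj₂ refl))))
      excluded (suc (suc (suc (suc (suc (suc (suc d))))))) _ _ _ = m≤m+n 7 d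

    flags-partition : flags₅ + flags₇ ≡ n
    flags-partition = begin
      flags₅ + flags₇
        ≡⟨ ∑-distrib-+ (five ∘ vertexOf) (other ∘ vertexOf) ⟨
      sum (λ x → five (vertexOf x) + other (vertexOf x))
        ≡⟨ sum-cong-≗ (λ x → 𝟙+𝟙¬ (degree (vertexOf x) Nat.≟ 5)) ⟩
      sum {n} (λ _ → 1)
        ≡⟨ ∑-ones n ⟩
      n ∎
      where open ≡-Reasoning

    weight : Fin #V → ℕ
    weight v = 42 * five v + 30 * other v

    420≤weight*flags : ∀ v → 420 ≤ weight v * fibreSize vertexOf v
    420≤weight*flags v = by-degree (degree v Nat.≟ 5)
      where
      by-degree : (d : Dec (degree v ≡ 5)) →
                  420 ≤ (42 * 𝟙 d + 30 * 𝟙 (¬? d)) * fibreSize vertexOf v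
      by-degree (yes d≡5) =
        *-monoʳ-≤ 42 (subst (λ d → d + d ≤ fibreSize vertexOf v) d≡5 (degree+degree≤flags v))
      by-degree (no d≢5)  = *-monoʳ-≤ 30 (≤-trans (+-mono-≤ seven≤d seven≤d) (degree+degree≤flags v))
        where seven≤d = seven-≤-degree v d≢5

    weight-bound : 420 * #V ≤ 42 * flags₅ + 30 * flags₇
    weight-bound = begin
      420 * #V                                         ≡⟨ trans (∑-const #V 420) (*-comm #V 420) ⟨
      sum {#V} (λ _ → 420)                             ≤⟨ ∑-mono-≤ 420≤weight*flags ⟩
      sum (λ v → weight v * fibreSize vertexOf v)      ≡⟨ ∑-fibres vertexOf weight ⟩
      sum (weight ∘ vertexOf)
        ≡⟨ ∑-distrib-+ (λ x → 42 * five (vertexOf x)) (λ x → 30 * other (vertexOf x)) ⟩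
      sum (λ x → 42 * five (vertexOf x)) + sum (λ x → 30 * other (vertexOf x))
        ≡⟨ cong₂ _+_ (*-distribˡ-sum 42 (five ∘ vertexOf)) (*-distribˡ-sum 30 (other ∘ vertexOf)) ⟨
      42 * flags₅ + 30 * flags₇                        ∎
      where open ≤-Reasoning

    charge : Fin n → ℕ
    charge y = five (vertexOf (α0 y))

    -- vertexOf y, vertexOf (α0 y) and vertexOf (α0 (α1 y)) are the corners of a triangle.
    charge-bound : ∀ y → charge y + charge (α1 y) ≤ other (vertexOf y)
    charge-bound y = by-degrees (degree (vertexOf (α0 y)) Nat.≟ 5) (degree (vertexOf (α0 (α1 y))) Nat.≟ 5)
                                (degree (vertexOf y) Nat.≟ 5)
      where
      by-degrees : (d₁ : Dec (degree (vertexOf (α0 y)) ≡ 5))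
                   (d₂ : Dec (degree (vertexOf (α0 (α1 y))) ≡ 5))
                   (d : Dec (degree (vertexOf y) ≡ 5)) → 𝟙 d₁ + 𝟙 d₂ ≤ 𝟙 (¬? d)
      by-degrees (yes p) _       (yes q) = ⊥-elim (no-adjacent-fives (_ , _ , (y , refl , refl) , q , p))
      by-degrees (yes p) (yes q) (no _)  = ⊥-elim (no-adjacent-fives (_ , _ , third-side y , p , q))
      by-degrees (yes _) (no _)  (no _)  = ≤-refl
      by-degrees (no _)  (yes q) (yes r) = ⊥-elim (no-adjacent-fives
        (_ , _ , (α1 y , refl , refl) , trans (cong degree (vertexOf-α1 y)) r , q))
      by-degrees (no _)  (yes _) (no _)  = ≤-refl
      by-degrees (no _)  (no _)  _       = z≤n

    flags₅+flags₅≤flags₇ : flags₅ + flags₅ ≤ flags₇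
    flags₅+flags₅≤flags₇ = begin
      flags₅ + flags₅
        ≡⟨ cong₂ _+_ ∑charge (trans (∑-involution α1 α1-invol charge) ∑charge) ⟨
      sum charge + sum (charge ∘ α1)         ≡⟨ ∑-distrib-+ charge (charge ∘ α1) ⟨
      sum (λ y → charge y + charge (α1 y))   ≤⟨ ∑-mono-≤ charge-bound ⟩
      flags₇                                 ∎
      where
      open ≤-Reasoning
      ∑charge : sum charge ≡ flags₅
      ∑charge = ∑-involution α0 α0-invol (five ∘ vertexOf)

    contradiction : ⊥
    contradiction = discharging-contradiction {V = #V} flags-partition
      (euler-flag-bound {V = #V} {E = #E} {F = #F} euler flags≡six-faces flags≤four-edges)
      weight-bound flags₅+flags₅≤flags₇

lemma2p17 : ∀ {n} (G : PPMultitriangulation n) →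
    let open PPMultitriangulation G in
    (∃ λ v → degree v ≡ 2 ⊎ degree v ≡ 3 ⊎ degree v ≡ 4 ⊎ degree v ≡ 6)
    ⊎ (∃ λ u → ∃ λ v → Adjacent u v × degree u ≡ 5 × degree v ≡ 5)
lemma2p17 G with Multitriangulation.light? G | Multitriangulation.adjacent-fives? G
... | yes light  | _          = inj₁ light
... | no _       | yes fives  = inj₂ fives
... | no ¬light  | no ¬fives  = ⊥-elim (Multitriangulation.Discharging.contradiction G ¬light ¬fives)
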